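{- Let $\bar{\mathbf x},\bar{\mathbf y}\in\mathbb{P}(\mathbb{Z})$ be distinct and non-adjacent, with transition-algorithm data $r,l$ and standard path as in the context. The standard path is a path in $G$ from $\bar{\mathbf x}$ to $\bar{\mathbf y}$. Its length is $r+l+1$ if $l>0$, and $2$ if $l=0$.
   Context: **Projective line and distant graph.** The points of $\mathbb{P}(\mathbb{Z})$ are the submodules $\bar{\mathbf v}=\mathbb{Z}\mathbf v\subset\mathbb{Z}^2$ with $\mathbf v=(a,b)$, $\gcd(a,b)=1$. A generator is a representative and is unique up to sign. Points are adjacent if $\det[\mathbf x,\mathbf y]=\pm1$. The distant graph $G$ has vertex set $\mathbb{P}(\mathbb{Z})$ and edges the adjacent pairs. The length of a path is its number of edges. **Transition algorithm** (for distinct non-adjacent $\bar{\mathbf x},\bar{\mathbf y}$, with fixed representatives $\mathbf x,\mathbf y$). - Put $P=\{\alpha\mathbf x+\beta\mathbf y:\alpha>0,\beta>0\}$ and $N=\{\alpha\mathbf x+\beta\mathbf y:\alpha<0,\beta>0\}$. - The integer vectors $\mathbf c$ with $|\det[\mathbf x,\mathbf c]|=1$ and $\beta>0$ form a sequence $\mathbf c_n=\mathbf c_0-n\mathbf x$. There is a unique $n$ with $\mathbf u:=\mathbf c_n\in P$ and $\mathbf w:=\mathbf c_{n+1}\in N$. - If $\mathbf u+\mathbf w=\mathbf y$, put $\mathbf e_1=\mathbf u$, $\mathbf f_1=\mathbf w$, $r=l=0$, and stop. - Otherwise let $Q_e$ be the one of $P,N$ containing $\mathbf u+\mathbf w$ and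 $Q_f$ the other. Let $\mathbf e_1$ be the one of $\mathbf u,\mathbf w$ in $Q_e$ and $\mathbf f_1$ the other. - Starting from the lists $(\mathbf e_1)$ and $(\mathbf f_1)$, repeat the following. Let $\mathbf s$ be the sum of the last entries. If $\mathbf s=\mathbf y$, stop. If $\mathbf s\in Q_e$, append it to the e-list (E-step). Otherwise append it to the f-list (F-step). - This terminates. The word of steps is $E^{a_1}F^{b_1}E^{a_2}F^{b_2}\cdots$ with all exponents $\ge1$, having $r$ E-blocks and $l$ F-blocks, so $r-l\in\{0,1\}$. - Put $a_0=b_0=1$, $A_k=\sum_{n=0}^k a_n$ and $B_k=\sum_{n=0}^k b_n$. The lists are $(\mathbf e_1,\dots,\mathbf e_{A_r})$ and $(\mathbf f_1,\dots,\mathbf f_{B_l})$. Bars denote the corresponding points. **Standard path.** - If $l=0$: $(\bar{\mathbf x},\bar{\mathbf f}_1,\bar{\mathbf y})$. - If $l\ge1$ and $r=l$: $(\bar{\mathbf x},\bar{\mathbf f}_{B_0},\bar{\mathbf e}_{A_1},\bar{\mathbf f}_{B_1},\dots,\bar{\mathbf f}_{B_{r-1}},\bar{\mathbf e}_{A_r},\bar{\mathbf y})$. - If $l\ge1$ and $r=l+1$: $(\bar{\mathbf x},\bar{\mathbf f}_{B_0},\bar{\mathbf e}_{A_1},\bar{\mathbf f}_{B_1},\dots,\bar{\mathbf e}_{A_{r-1}},\bar{\mathbf f}_{B_{r-1}},\bar{\mathbf y})$. -}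

module Defs where

open import Data.Nat as ℕ using (ℕ; zero; suc; _∸_)
open import Data.Integer as ℤ using (ℤ; +_; ∣_∣)
open import Data.Integer.GCD using (gcd)
open import Data.Product using (_×_; _,_; proj₁; proj₂)
open import Data.Sum using (_⊎_)
open import Data.List using (List; []; _∷_; _++_; length; take)
open import Data.Nat.ListAction using (sum)
open import Relation.Binary.PropositionalEquality using (_≡_; _≢_)
open import Relation.Nullary using (¬_; yes; no)

V : Set
V = ℤ × ℤ

_+ᵥ_ : V → V → V
(a , b) +ᵥ (c , d) = (a ℤ.+ c) , (b ℤ.+ d)

_-ᵥ_ : V → V → V
(a , b) -ᵥ (c , d) = (a ℤ.- c) , (b ℤ.- d)

negᵥ : V → V
negᵥ (a , b) = (ℤ.- a) , (ℤ.- b)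

det : V → V → ℤ
det (a , b) (c , d) = (a ℤ.* d) ℤ.- (b ℤ.* c)

-- v = (a,b) with gcd(a,b) = 1 : a generator of a point of P(ℤ)
Primitive : V → Set
Primitive (a , b) = gcd a b ≡ + 1

SamePoint : V → V → Set
SamePoint v w = (v ≡ w) ⊎ (v ≡ negᵥ w)

Adjacent : V → V → Set
Adjacent v w = ∣ det v w ∣ ≡ 1

IsWalk : List V → Set
IsWalk [] = Data.Unit.⊤ where import Data.Unit
IsWalk (v ∷ []) = Primitive v
IsWalk (v ∷ w ∷ vs) = Primitive v × Adjacent v w × IsWalk (w ∷ vs)

headIs : List V → V → Set
headIs [] _ = Data.Empty.⊥ where import Data.Empty
headIs (v ∷ _) x = SamePoint v x

lastIs : List V → V → Set
lastIs [] _ = Data.Empty.⊥ where import Data.Empty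
lastIs (v ∷ []) y = SamePoint v y
lastIs (_ ∷ w ∷ vs) y = lastIs (w ∷ vs) y

IsPathFromTo : List V → V → V → Set
IsPathFromTo p x y = IsWalk p × headIs p x × lastIs p y

pathLength : List V → ℕ
pathLength p = length p ∸ 1

-- For c = αx + βy one has det[x,c] = β·det[x,y] and det[c,y] = α·det[x,y]
-- (Cramer's rule), so the sign conditions on α, β read as follows.

data Region : Set where
  Pc Nc : Region

InP : V → V → V → Set
InP x y c = (+ 0 ℤ.< det x c ℤ.* det x y) × (+ 0 ℤ.< det c y ℤ.* det x y)

InN : V → V → V → Set
InN x y c = (+ 0 ℤ.< det x c ℤ.* det x y) × (det c y ℤ.* det x y ℤ.< + 0)

In : V → V → Region → V → Set
In x y Pc c = InP x y c
In x y Nc c = InN x y c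

data Step : Set where
  E F : Step

IsU : V → V → V → Set
IsU x y u = (∣ det x u ∣ ≡ 1) × InP x y u × InN x y (u -ᵥ x)

-- The loop: Loop x y Qe e f word  means that starting with last entries
-- e (of the e-list) and f (of the f-list), the loop performs the steps
-- in `word` and then stops (because the sum equals y).
data Loop (x y : V) (Qe : Region) : V → V → List Step → Set where
  done  : ∀ {e f} → e +ᵥ f ≡ y → Loop x y Qe e f []
  stepE : ∀ {e f w} → e +ᵥ f ≢ y → In x y Qe (e +ᵥ f) →
          Loop x y Qe (e +ᵥ f) f w → Loop x y Qe e f (E ∷ w)
  stepF : ∀ {e f w} → e +ᵥ f ≢ y → ¬ In x y Qe (e +ᵥ f) →
          Loop x y Qe e (e +ᵥ f) w → Loop x y Qe e f (F ∷ w)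

-- Transition x y e₁ f₁ word : the algorithm on (x, y) yields e₁, f₁ and
-- the word of steps `word` (empty in the immediate-stop case r = l = 0).
data Transition (x y : V) : V → V → List Step → Set where
  stop : ∀ {u} → IsU x y u → u +ᵥ (u -ᵥ x) ≡ y →
         Transition x y u (u -ᵥ x) []
  runP : ∀ {u w} → IsU x y u → u +ᵥ (u -ᵥ x) ≢ y →
         InP x y (u +ᵥ (u -ᵥ x)) →
         Loop x y Pc u (u -ᵥ x) w → Transition x y u (u -ᵥ x) w
  runN : ∀ {u w} → IsU x y u → u +ᵥ (u -ᵥ x) ≢ y →
         InN x y (u +ᵥ (u -ᵥ x)) →
         Loop x y Nc (u -ᵥ x) u w → Transition x y (u -ᵥ x) u w

sim : V → V → List Step → List V × List V
sim e f [] = [] , []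
sim e f (E ∷ w) = let r = sim (e +ᵥ f) f w in ((e +ᵥ f) ∷ proj₁ r) , proj₂ r
sim e f (F ∷ w) = let r = sim e (e +ᵥ f) w in proj₁ r , ((e +ᵥ f) ∷ proj₂ r)

eList fList : V → V → List Step → List V
eList e₁ f₁ w = e₁ ∷ proj₁ (sim e₁ f₁ w)
fList e₁ f₁ w = f₁ ∷ proj₂ (sim e₁ f₁ w)

-- 1-based indexing (out of range gives the zero vector, never used)
at : List V → ℕ → V
at (v ∷ vs) 1 = v
at (v ∷ vs) (suc (suc n)) = at vs (suc n)
at _ _ = + 0 , + 0

_≟ₛ_ : (s t : Step) → Relation.Nullary.Dec (s ≡ t)
E ≟ₛ E = yes Relation.Binary.PropositionalEquality.refl
F ≟ₛ F = yes Relation.Binary.PropositionalEquality.refl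
E ≟ₛ F = no (λ ())
F ≟ₛ E = no (λ ())

rle : List Step → List (Step × ℕ)
rle [] = []
rle (s ∷ w) with rle w
... | [] = (s , 1) ∷ []
... | (t , n) ∷ rest with s ≟ₛ t
...   | yes _ = (t , suc n) ∷ rest
...   | no _  = (s , 1) ∷ (t , n) ∷ rest

blocksOf : Step → List (Step × ℕ) → List ℕ
blocksOf s [] = []
blocksOf s ((t , n) ∷ bs) with s ≟ₛ t
... | yes _ = n ∷ blocksOf s bs
... | no _  = blocksOf s bs

as bs : List Step → List ℕ
as w = blocksOf E (rle w)
bs w = blocksOf F (rle w)

rOf lOf : List Step → ℕ
rOf w = length (as w)
lOf w = length (bs w)

-- A_k = a₀ + … + a_k, B_k = b₀ + … + b_k with a₀ = b₀ = 1
Aₖ Bₖ : List Step → ℕ → ℕ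
Aₖ w k = 1 ℕ.+ sum (take k (as w))
Bₖ w k = 1 ℕ.+ sum (take k (bs w))

module _ (e₁ f₁ : V) (w : List Step) where
  ē f̄ : ℕ → V
  ē i = at (eList e₁ f₁ w) i
  f̄ j = at (fList e₁ f₁ w) j

  alt : ℕ → List V
  alt zero = []
  alt (suc k) = alt k ++ (f̄ (Bₖ w k) ∷ ē (Aₖ w (suc k)) ∷ [])

standardPath : V → V → V → V → List Step → List V
standardPath x y e₁ f₁ w with lOf w | rOf w ℕ.≟ lOf w
... | zero  | _     = x ∷ f₁ ∷ y ∷ []
... | suc _ | yes _ = x ∷ (alt e₁ f₁ w (rOf w) ++ (y ∷ []))
-- r = l + 1, l ≥ 1
... | suc _ | no _  = x ∷ (alt e₁ f₁ w (rOf w ∸ 1) ++ (f̄ e₁ f₁ w (Bₖ w (rOf w ∸ 1)) ∷ y ∷ []))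

-- Adding one entry of a pair to the other preserves the determinant, so every pair (e, f)
-- of last entries of the e- and f-lists is unimodular, as is the initial pair: det[e₁,f₁]
-- = ±det[x,u] = ±1. The inner vertices e_{A_k}, f_{B_k} of the standard path are the last
-- entries at the block boundaries of the word E^{a₁} F^{b₁} ⋯, so consecutive ones are
-- adjacent; x is adjacent to f₁ = u - x (resp. u), and the final pair sums to y, so both of
-- its entries are adjacent to y.
module Submission where

open import Defs
open import Data.Empty using (⊥-elim)
open import Data.Integer as ℤ using (∣_∣; _*_; _-_; -_)
import Data.Integer.Properties as ℤₚ
open import Data.Integer.Tactic.RingSolver using (solve-∀)
import Data.Integer.Divisibility.Signed as ℤ∣
open import Data.Integer.GCD using (gcd; gcd[i,j]∣i; gcd[i,j]∣j)
open import Data.List using (List; []; _∷_; _++_; length; take; replicate; filter)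
open import Data.List.Properties using (++-assoc; ++-identityʳ; length-++; take-all; filter-accept; filter-reject)
open import Data.List.Relation.Unary.Linked using (Linked; []; [-]; _∷_)
open import Data.Nat as ℕ using (ℕ; zero; suc; _+_; _∸_; _≤_; _<_; z≤n; s≤s)
import Data.Nat.Divisibility as ℕ∣
open import Data.Nat.ListAction using (sum)
open import Data.Nat.Properties using (≤-refl; ≤-reflexive; ≤-trans; n≤1+n; m∸n≤m)
import Data.Nat.Tactic.RingSolver as ℕ
open import Data.Product using (_×_; _,_; proj₁; proj₂; ∃₂; uncurry)
open import Function using (_∘_)
open import Data.Sum using (_⊎_; inj₁; inj₂)
open import Relation.Binary.PropositionalEquality
open import Relation.Nullary using (¬_; yes; no)

det[e+f,f]≡det[e,f] : ∀ e f → det (e +ᵥ f) f ≡ det e f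
det[e+f,f]≡det[e,f] (a , b) (c , d) = identity a b c d
  where
  identity : ∀ a b c d → (a ℤ.+ c) * d - (b ℤ.+ d) * c ≡ a * d - b * c
  identity = solve-∀

det[e,e+f]≡det[e,f] : ∀ e f → det e (e +ᵥ f) ≡ det e f
det[e,e+f]≡det[e,f] (a , b) (c , d) = identity a b c d
  where
  identity : ∀ a b c d → a * (b ℤ.+ d) - b * (a ℤ.+ c) ≡ a * d - b * c
  identity = solve-∀

det[f,e]≡-det[e,f] : ∀ e f → det f e ≡ - det e f
det[f,e]≡-det[e,f] (a , b) (c , d) = identity a b c d
  where
  identity : ∀ a b c d → c * b - d * a ≡ - (a * d - b * c)
  identity = solve-∀

det[x,u-x]≡det[x,u] : ∀ x u → det x (u -ᵥ x) ≡ det x u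
det[x,u-x]≡det[x,u] (a , b) (c , d) = identity a b c d
  where
  identity : ∀ a b c d → a * (d - b) - b * (c - a) ≡ a * d - b * c
  identity = solve-∀

det[u,u-x]≡det[x,u] : ∀ x u → det u (u -ᵥ x) ≡ det x u
det[u,u-x]≡det[x,u] (a , b) (c , d) = identity a b c d
  where
  identity : ∀ a b c d → c * (d - b) - d * (c - a) ≡ a * d - b * c
  identity = solve-∀

+ᵥ-comm : ∀ e f → e +ᵥ f ≡ f +ᵥ e
+ᵥ-comm (a , b) (c , d) = cong₂ _,_ (ℤₚ.+-comm a c) (ℤₚ.+-comm b d)

adjacent-sym : ∀ e f → Adjacent e f → Adjacent f e
adjacent-sym e f adj = begin
  ∣ det f e ∣     ≡⟨ cong ∣_∣ (det[f,e]≡-det[e,f] e f) ⟩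
  ∣ - det e f ∣   ≡⟨ ℤₚ.∣-i∣≡∣i∣ (det e f) ⟩
  ∣ det e f ∣     ≡⟨ adj ⟩
  1               ∎
  where open ≡-Reasoning

adjacent-sumˡ : ∀ e f → Adjacent e f → Adjacent (e +ᵥ f) f
adjacent-sumˡ e f = subst (_≡ 1) (cong ∣_∣ (sym (det[e+f,f]≡det[e,f] e f)))

adjacent-sumʳ : ∀ e f → Adjacent e f → Adjacent e (e +ᵥ f)
adjacent-sumʳ e f = subst (_≡ 1) (cong ∣_∣ (sym (det[e,e+f]≡det[e,f] e f)))

adjacent-[u-x]ʳ : ∀ x u → Adjacent x u → Adjacent x (u -ᵥ x)
adjacent-[u-x]ʳ x u = subst (_≡ 1) (cong ∣_∣ (sym (det[x,u-x]≡det[x,u] x u)))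

adjacent-[u-x]ˡ : ∀ x u → Adjacent x u → Adjacent u (u -ᵥ x)
adjacent-[u-x]ˡ x u = subst (_≡ 1) (cong ∣_∣ (sym (det[u,u-x]≡det[x,u] x u)))

-- gcd(a, b) divides det[(a,b), w], which is ±1.
adjacent⇒primitive : ∀ v w → Adjacent v w → Primitive v
adjacent⇒primitive (a , b) (c , d) adj =
  cong ℤ.+_ (ℕ∣.∣1⇒≡1 (subst (∣ g ∣ ℕ∣.∣_) adj (ℤ∣.∣⇒∣ᵤ {g} gcd∣det)))
  where
  g = gcd a b
  gcd∣det : g ℤ∣.∣ (a * d - b * c)
  gcd∣det = ℤ∣.∣m∣n⇒∣m-n {g} {a * d} {b * c}
    (ℤ∣.∣m⇒∣m*n {g} {a} d (ℤ∣.∣ᵤ⇒∣ {g} {a} (gcd[i,j]∣i a b)))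
    (ℤ∣.∣m⇒∣m*n {g} {b} c (ℤ∣.∣ᵤ⇒∣ {g} {b} (gcd[i,j]∣j a b)))

-- The pair of last entries of the e- and f-lists after the steps of a word.
run : V → V → List Step → V × V
run e f []      = e , f
run e f (E ∷ p) = run (e +ᵥ f) f p
run e f (F ∷ p) = run e (e +ᵥ f) p

adjacent-run : ∀ e f p → Adjacent e f → uncurry Adjacent (run e f p)
adjacent-run e f []      adj = adj
adjacent-run e f (E ∷ p) adj = adjacent-run (e +ᵥ f) f p (adjacent-sumˡ e f adj)
adjacent-run e f (F ∷ p) adj = adjacent-run e (e +ᵥ f) p (adjacent-sumʳ e f adj)

loop-run-sum : ∀ {x y Qe e f w} → Loop x y Qe e f w → uncurry _+ᵥ_ (run e f w) ≡ y
loop-run-sum (done e+f≡y)  = e+f≡y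
loop-run-sum (stepE _ _ l) = loop-run-sum l
loop-run-sum (stepF _ _ l) = loop-run-sum l

count : Step → List Step → ℕ
count s w = length (filter (s ≟ₛ_) w)

at-count≡run : ∀ e f p q →
  (at (eList e f (p ++ q)) (suc (count E p)) , at (fList e f (p ++ q)) (suc (count F p)))
  ≡ run e f p
at-count≡run e f []      q = refl
at-count≡run e f (E ∷ p) q = at-count≡run (e +ᵥ f) f p q
at-count≡run e f (F ∷ p) q = at-count≡run e (e +ᵥ f) p q

other : Step → Step
other E = F
other F = E

≢⇒other : ∀ {s t} → s ≢ t → t ≡ other s
≢⇒other {E} {E} s≢t = ⊥-elim (s≢t refl)
≢⇒other {E} {F} _   = refl
≢⇒other {F} {E} _   = refl
≢⇒other {F} {F} s≢t = ⊥-elim (s≢t refl)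

data Alternating : Step → List (Step × ℕ) → Set where
  []    : ∀ {s} → Alternating s []
  block : ∀ {s n L} → Alternating (other s) L → Alternating s ((s , n) ∷ L)

rle-alternating : ∀ s w → Alternating s (rle (s ∷ w))
rle-alternating s [] = block []
rle-alternating s (t ∷ w) with rle (t ∷ w) | rle-alternating t w
... | [] | _ = block []
... | (t , n) ∷ blocks | block alt with s ≟ₛ t
...   | yes refl = block alt
...   | no s≢t   = block (subst (λ u → Alternating u ((t , n) ∷ blocks)) (≢⇒other s≢t) (block alt))

expand : List (Step × ℕ) → List Step
expand []             = []
expand ((s , n) ∷ L) = replicate n s ++ expand L

expand-rle : ∀ w → expand (rle w) ≡ w
expand-rle [] = refl
expand-rle (s ∷ w) with rle w | expand-rle w
... | [] | eq = cong (s ∷_) eq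
... | (t , n) ∷ blocks | eq with s ≟ₛ t
...   | yes refl = cong (s ∷_) eq
...   | no _     = cong (s ∷_) eq

count-replicate-self : ∀ s n p → count s (replicate n s ++ p) ≡ n + count s p
count-replicate-self s zero    p = refl
count-replicate-self s (suc n) p =
  trans (cong length (filter-accept (s ≟ₛ_) refl)) (cong suc (count-replicate-self s n p))

count-replicate-other : ∀ {s t} → t ≢ s → ∀ n p → count t (replicate n s ++ p) ≡ count t p
count-replicate-other t≢s zero    p = refl
count-replicate-other t≢s (suc n) p =
  trans (cong length (filter-reject (_ ≟ₛ_) t≢s)) (count-replicate-other t≢s n p)

HasPrefixWithCounts : Step → Step → List Step → ℕ → ℕ → Set
HasPrefixWithCounts s t w i j = ∃₂ λ p q → w ≡ p ++ q × count s p ≡ i × count t p ≡ j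

prefix-[] : ∀ {s t} w → HasPrefixWithCounts s t w 0 0
prefix-[] w = [] , w , refl , refl , refl

prefix-replicate : ∀ {s t w i j} → t ≢ s → ∀ n →
  HasPrefixWithCounts t s w i j → HasPrefixWithCounts s t (replicate n s ++ w) (n + j) i
prefix-replicate {s} {t} t≢s n (p , q , refl , cₜ , cₛ) =
  replicate n s ++ p , q , sym (++-assoc (replicate n s) p q) ,
  trans (count-replicate-self s n p) (cong (n +_) cₛ) ,
  trans (count-replicate-other t≢s n p) cₜ

-- For w = s^{a₁} t^{b₁} s^{a₂} t^{b₂} ⋯: the letter counts of its prefixes ending at block boundaries.
record BlockBoundaries (s t : Step) (w : List Step) (a b : List ℕ) : Set where
  field
    lengths : length a ≡ length b ⊎ length a ≡ suc (length b)
    after-s : ∀ k → k < length a → HasPrefixWithCounts s t w (sum (take (suc k) a)) (sum (take k b))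
    after-t : ∀ k → k ≤ length b → HasPrefixWithCounts s t w (sum (take k a)) (sum (take k b))
    total-s : count s w ≡ sum a
    total-t : count t w ≡ sum b

boundaries-[] : ∀ {s t} → BlockBoundaries s t [] [] []
boundaries-[] = record
  { lengths = inj₁ refl
  ; after-s = λ _ ()
  ; after-t = λ { zero _ → prefix-[] [] }
  ; total-s = refl
  ; total-t = refl
  }

boundaries-block : ∀ {s t w a b} → t ≢ s → ∀ n →
  BlockBoundaries t s w b a → BlockBoundaries s t (replicate n s ++ w) (n ∷ a) b
boundaries-block {s} {t} {w} {a} {b} t≢s n bb = record
  { lengths = swap lengths
  ; after-s = λ { k (s≤s k≤a) → prefix-replicate t≢s n (after-t k k≤a) }
  ; after-t = λ { zero _ → prefix-[] _ ; (suc k) k<b → prefix-replicate t≢s n (after-s k k<b) }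
  ; total-s = trans (count-replicate-self s n w) (cong (n +_) total-t)
  ; total-t = trans (count-replicate-other t≢s n w) total-s
  }
  where
  open BlockBoundaries bb
  swap : length b ≡ length a ⊎ length b ≡ suc (length a) →
         suc (length a) ≡ length b ⊎ suc (length a) ≡ suc (length b)
  swap (inj₁ b≡a)  = inj₂ (cong suc (sym b≡a))
  swap (inj₂ b≡1+a) = inj₁ (sym b≡1+a)

blockBoundaries : ∀ s L → Alternating s L →
  BlockBoundaries s (other s) (expand L) (blocksOf s L) (blocksOf (other s) L)
blockBoundaries s []                   []          = boundaries-[]
blockBoundaries E ((E , n) ∷ L) (block alt) = boundaries-block (λ ()) n (blockBoundaries F L alt)
blockBoundaries F ((F , n) ∷ L) (block alt) = boundaries-block (λ ()) n (blockBoundaries E L alt)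

record TransitionInvariants (x y e₁ f₁ : V) (w : List Step) : Set where
  field
    x-adjacent-f₁  : Adjacent x f₁
    e₁-adjacent-f₁ : Adjacent e₁ f₁
    run-sum≡y      : uncurry _+ᵥ_ (run e₁ f₁ w) ≡ y
    alternating    : Alternating E (rle w)

-- The first sum lies in Q_e, so the loop begins with an E-step.
loop-alternating : ∀ {x y Qe e f w} → e +ᵥ f ≢ y → In x y Qe (e +ᵥ f) →
  Loop x y Qe e f w → Alternating E (rle w)
loop-alternating e+f≢y _      (done e+f≡y)          = ⊥-elim (e+f≢y e+f≡y)
loop-alternating _     _      (stepE {w = w} _ _ _) = rle-alternating E w
loop-alternating _     e+f∈Qe (stepF _ e+f∉Qe _)    = ⊥-elim (e+f∉Qe e+f∈Qe)

transition-invariants : ∀ {x y e₁ f₁ w} → Transition x y e₁ f₁ w → TransitionInvariants x y e₁ f₁ w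
transition-invariants {x} (stop {u} (x-adj-u , _) u+[u-x]≡y) = record
  { x-adjacent-f₁  = adjacent-[u-x]ʳ x u x-adj-u
  ; e₁-adjacent-f₁ = adjacent-[u-x]ˡ x u x-adj-u
  ; run-sum≡y      = u+[u-x]≡y
  ; alternating    = []
  }
transition-invariants {x} (runP {u} (x-adj-u , _) ne inP loop) = record
  { x-adjacent-f₁  = adjacent-[u-x]ʳ x u x-adj-u
  ; e₁-adjacent-f₁ = adjacent-[u-x]ˡ x u x-adj-u
  ; run-sum≡y      = loop-run-sum loop
  ; alternating    = loop-alternating ne inP loop
  }
transition-invariants {x} {y} (runN {u} (x-adj-u , _) ne inN loop) = record
  { x-adjacent-f₁  = x-adj-u
  ; e₁-adjacent-f₁ = adjacent-sym u (u -ᵥ x) (adjacent-[u-x]ˡ x u x-adj-u)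
  ; run-sum≡y      = loop-run-sum loop
  ; alternating    = loop-alternating (ne ∘ trans (+ᵥ-comm u (u -ᵥ x)))
                                      (subst (InN x y) (+ᵥ-comm u (u -ᵥ x)) inN) loop
  }

adjacent-at-prefix : ∀ {e f w i j} → Adjacent e f → HasPrefixWithCounts E F w i j →
  Adjacent (at (eList e f w) (suc i)) (at (fList e f w) (suc j))
adjacent-at-prefix {e} {f} adj (p , q , refl , refl , refl) =
  subst (uncurry Adjacent) (sym (at-count≡run e f p q)) (adjacent-run e f p adj)

at-total≡run : ∀ e f w →
  (at (eList e f w) (suc (count E w)) , at (fList e f w) (suc (count F w))) ≡ run e f w
at-total≡run e f w =
  subst (λ v → (at (eList e f v) (suc (count E w)) , at (fList e f v) (suc (count F w))) ≡ run e f w)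
        (++-identityʳ w) (at-count≡run e f w [])

adjacent-to-sum : ∀ e f {y} → Adjacent e f → e +ᵥ f ≡ y → Adjacent e y × Adjacent f y
adjacent-to-sum e f adj refl = adjacent-sumʳ e f adj , adjacent-sym (e +ᵥ f) f (adjacent-sumˡ e f adj)

walk-of-linked : ∀ {u L} → Primitive u → Linked Adjacent (u ∷ L) → IsWalk (u ∷ L)
walk-of-linked             prim [-]           = prim
walk-of-linked {u} {v ∷ _} prim (adj ∷ chain) =
  prim , adj , walk-of-linked (adjacent⇒primitive v u (adjacent-sym u v adj)) chain

lastIs-++ : ∀ u L {v M y} → lastIs (v ∷ M) y → lastIs (u ∷ L ++ v ∷ M) y
lastIs-++ u []       last = last
lastIs-++ u (u′ ∷ L) last = lastIs-++ u′ L last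

path-of-linked : ∀ {x y} L {v M} → Primitive x → Linked Adjacent (x ∷ L ++ v ∷ M) →
  lastIs (v ∷ M) y → IsPathFromTo (x ∷ L ++ v ∷ M) x y
path-of-linked {x} L prim chain last = walk-of-linked prim chain , inj₁ refl , lastIs-++ x L last

length-alt : ∀ e f w k → length (alt e f w k) ≡ k + k
length-alt e f w zero    = refl
length-alt e f w (suc k) = begin
  length (alt e f w k ++ _)  ≡⟨ length-++ (alt e f w k) ⟩
  length (alt e f w k) + 2   ≡⟨ cong (_+ 2) (length-alt e f w k) ⟩
  k + k + 2                  ≡⟨ identity k ⟩
  suc k + suc k              ∎
  where
  open ≡-Reasoning
  identity : ∀ k → k + k + 2 ≡ suc k + suc k
  identity = ℕ.solve-∀

pathLength-alt : ∀ x e f w k M → pathLength (x ∷ alt e f w k ++ M) ≡ k + k + length M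
pathLength-alt x e f w k M = trans (length-++ (alt e f w k)) (cong (_+ length M) (length-alt e f w k))

odd-length : ∀ r l → r ≡ suc l → r ∸ 1 + (r ∸ 1) + 2 ≡ r + l + 1
odd-length .(suc l) l refl = identity l
  where
  identity : ∀ l → l + l + 2 ≡ suc l + l + 1
  identity = ℕ.solve-∀

module StandardPath {x y e₁ f₁ : V} {w : List Step} (inv : TransitionInvariants x y e₁ f₁ w) where
  open TransitionInvariants inv

  blocks : BlockBoundaries E F w (as w) (bs w)
  blocks = subst (λ v → BlockBoundaries E F v (as w) (bs w)) (expand-rle w)
                 (blockBoundaries E (rle w) alternating)

  open BlockBoundaries blocks

  -- The standard path is x, f_{B₀}, e_{A₁}, f_{B₁}, e_{A₂}, …: x takes the place of e_{A₀}.
  eVertex : ℕ → V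
  eVertex zero    = x
  eVertex (suc k) = ē e₁ f₁ w (Aₖ w (suc k))

  fVertex : ℕ → V
  fVertex k = f̄ e₁ f₁ w (Bₖ w k)

  eVertex≡e[Aₖ] : ∀ k → 0 < k → eVertex k ≡ ē e₁ f₁ w (Aₖ w k)
  eVertex≡e[Aₖ] (suc k) _ = refl

  eVertex-adjacent-fVertex : ∀ k → k ≤ lOf w → Adjacent (eVertex k) (fVertex k)
  eVertex-adjacent-fVertex zero    _   = x-adjacent-f₁
  eVertex-adjacent-fVertex (suc k) k≤l = adjacent-at-prefix e₁-adjacent-f₁ (after-t (suc k) k≤l)

  fVertex-adjacent-eVertex : ∀ k → k < rOf w → Adjacent (fVertex k) (eVertex (suc k))
  fVertex-adjacent-eVertex k k<r =
    adjacent-sym (eVertex (suc k)) (fVertex k) (adjacent-at-prefix e₁-adjacent-f₁ (after-s k k<r))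

  r≤1+l : rOf w ≤ suc (lOf w)
  r≤1+l with lengths
  ... | inj₁ r≡l   = ≤-trans (≤-reflexive r≡l) (n≤1+n (lOf w))
  ... | inj₂ r≡1+l = ≤-reflexive r≡1+l

  linked-alt : ∀ k → k ≤ rOf w → ∀ M → Linked Adjacent (eVertex k ∷ M) →
    Linked Adjacent (x ∷ alt e₁ f₁ w k ++ M)
  linked-alt zero    _   M chain = chain
  linked-alt (suc k) k<r M chain
    rewrite ++-assoc (alt e₁ f₁ w k) (fVertex k ∷ eVertex (suc k) ∷ []) M =
    linked-alt k (≤-trans (n≤1+n k) k<r) (fVertex k ∷ eVertex (suc k) ∷ M)
      (eVertex-adjacent-fVertex k (ℕ.≤-pred (≤-trans k<r r≤1+l))
       ∷ fVertex-adjacent-eVertex k k<r ∷ chain)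

  final-vertices : (ē e₁ f₁ w (Aₖ w (rOf w)) , f̄ e₁ f₁ w (Bₖ w (lOf w))) ≡ run e₁ f₁ w
  final-vertices = trans
    (cong₂ (λ i j → at (eList e₁ f₁ w) (suc i) , at (fList e₁ f₁ w) (suc j))
           (trans (cong sum (take-all (rOf w) (as w) ≤-refl)) (sym total-s))
           (trans (cong sum (take-all (lOf w) (bs w) ≤-refl)) (sym total-t)))
    (at-total≡run e₁ f₁ w)

  final-adjacent-y : Adjacent (ē e₁ f₁ w (Aₖ w (rOf w))) y × Adjacent (fVertex (lOf w)) y
  final-adjacent-y = subst (uncurry λ e f → Adjacent e y × Adjacent f y) (sym final-vertices)
    (adjacent-to-sum (proj₁ (run e₁ f₁ w)) (proj₂ (run e₁ f₁ w)) (adjacent-run e₁ f₁ w e₁-adjacent-f₁) run-sum≡y)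

  r≢l⇒r≡1+l : rOf w ≢ lOf w → rOf w ≡ suc (lOf w)
  r≢l⇒r≡1+l r≢l with lengths
  ... | inj₁ r≡l   = ⊥-elim (r≢l r≡l)
  ... | inj₂ r≡1+l = r≡1+l

  module _ (prim-x : Primitive x) where

    short-path : lOf w ≡ 0 → IsPathFromTo (x ∷ f₁ ∷ y ∷ []) x y
    short-path l≡0 = path-of-linked [] prim-x
      (x-adjacent-f₁ ∷ subst (λ k → Adjacent (fVertex k) y) l≡0 (proj₂ final-adjacent-y) ∷ [-])
      (inj₁ refl)

    even-path : 0 < rOf w → IsPathFromTo (x ∷ alt e₁ f₁ w (rOf w) ++ y ∷ []) x y
    even-path 0<r = path-of-linked (alt e₁ f₁ w (rOf w)) prim-x
      (linked-alt (rOf w) ≤-refl (y ∷ [])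
        (subst (λ v → Adjacent v y) (sym (eVertex≡e[Aₖ] (rOf w) 0<r)) (proj₁ final-adjacent-y) ∷ [-]))
      (inj₁ refl)

    odd-path : rOf w ≡ suc (lOf w) →
      IsPathFromTo (x ∷ alt e₁ f₁ w (rOf w ∸ 1) ++ fVertex (rOf w ∸ 1) ∷ y ∷ []) x y
    odd-path r≡1+l = path-of-linked (alt e₁ f₁ w (rOf w ∸ 1)) prim-x
      (linked-alt (rOf w ∸ 1) (m∸n≤m (rOf w) 1) (fVertex (rOf w ∸ 1) ∷ y ∷ [])
        (eVertex-adjacent-fVertex (rOf w ∸ 1) (≤-reflexive r∸1≡l)
         ∷ subst (λ k → Adjacent (fVertex k) y) (sym r∸1≡l) (proj₂ final-adjacent-y) ∷ [-]))
      (inj₁ refl)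
      where
      r∸1≡l : rOf w ∸ 1 ≡ lOf w
      r∸1≡l = cong (_∸ 1) r≡1+l

    standardPath-correct :
      IsPathFromTo (standardPath x y e₁ f₁ w) x y
      × (0 < lOf w → pathLength (standardPath x y e₁ f₁ w) ≡ rOf w + lOf w + 1)
      × (lOf w ≡ 0 → pathLength (standardPath x y e₁ f₁ w) ≡ 2)
    standardPath-correct with lOf w in l≡ | rOf w ℕ.≟ lOf w
    ... | zero  | _ = short-path l≡ , (λ ()) , λ _ → refl
    ... | suc l | yes r≡1+l′ =
      even-path (subst (0 <_) (sym r≡1+l′) (s≤s z≤n)) ,
      (λ _ → trans (pathLength-alt x e₁ f₁ w (rOf w) (y ∷ [])) (cong (λ m → rOf w + m + 1) r≡1+l′)) ,
      λ ()
    ... | suc l | no r≢1+l′ =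
      odd-path r≡1+l ,
      (λ _ → trans (pathLength-alt x e₁ f₁ w (rOf w ∸ 1) _)
                   (trans (odd-length (rOf w) (lOf w) r≡1+l) (cong (λ m → rOf w + m + 1) l≡))) ,
      λ ()
      where
      r≡1+l : rOf w ≡ suc (lOf w)
      r≡1+l = r≢l⇒r≡1+l (λ r≡l → r≢1+l′ (trans r≡l l≡))

lemma3 : (x y : V) → Primitive x → Primitive y →
         ¬ SamePoint x y → ¬ Adjacent x y →
         (e₁ f₁ : V) (w : List Step) → Transition x y e₁ f₁ w →
         IsPathFromTo (standardPath x y e₁ f₁ w) x y
         × (0 < lOf w → pathLength (standardPath x y e₁ f₁ w) ≡ rOf w + lOf w + 1)
         × (lOf w ≡ 0 → pathLength (standardPath x y e₁ f₁ w) ≡ 2)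
lemma3 x y prim-x _ _ _ e₁ f₁ w transition =
  StandardPath.standardPath-correct (transition-invariants transition) prim-x
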